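{- For any $N$ that is a multiple of $3$, the graph $\mathcal{H}_N$ is connected.
   Context: Label the points of a convex $N$-gon $1,\ldots,N$ counterclockwise and color them red, blue, green alternatingly (point $i$ is red, blue, or green according as $i\equiv 1,2,0 \pmod 3$). Let $\mathcal{C}'_N$ be the set of triangulations of the convex $N$-gon in which every triangle has one point of each of the three colors. A twist is the following operation: if a triangle of the triangulation has each of its three edges shared with another triangle, then the union of these four triangles is a hexagon with vertices $h_1,\ldots,h_6$ in circular order, triangulated by the inner triangle $h_1h_3h_5$ and the triangles $h_1h_2h_3$, $h_3h_4h_5$, $h_5h_6h_1$; the twist replaces this by the triangulation of the hexagon with inner triangle $h_2h_4h_6$ and triangles $h_2h_3h_4$, $h_4h_5h_6$, $h_6h_1h_2$, leaving the rest unchanged. $\mathcal{H}_N$ is the graph with node set $\mathcal{C}'_N$ and an edge between two triangulations that differ in a twist. -}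

module Defs where

open import Data.Nat using (ℕ; suc; _<_; _%_)
open import Data.Nat.Divisibility using (_∣_)
open import Data.List using (List; []; _∷_; _++_; map; upTo)
open import Data.List.Relation.Unary.All using (All)
open import Data.List.Relation.Binary.Permutation.Propositional using (_↭_)
open import Data.Product using (_×_; _,_; ∃-syntax)
open import Data.Sum using (_⊎_)
open import Relation.Binary.PropositionalEquality using (_≢_)

-- Points of the convex N-gon are labelled 1,…,N counterclockwise.
polygon : ℕ → List ℕ
polygon N = map suc (upTo N)

-- A triangle is a triple of labels (a , b , c), listed in increasing
-- (= counterclockwise) order.
Triangle : Set
Triangle = ℕ × ℕ × ℕ

-- Standard recursive description: a single edge has the empty
-- triangulation; otherwise the edge from the first vertex a to the last
-- vertex z lies in exactly one triangle (a , m , z), and the remaining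
-- triangles triangulate the two sub-polygons a…m and m…z.
data Triangulation : List ℕ → List Triangle → Set where
  edge  : ∀ a b → Triangulation (a ∷ b ∷ []) []
  split : ∀ a m z xs ys T₁ T₂ →
          Triangulation (a ∷ xs ++ m ∷ []) T₁ →
          Triangulation (m ∷ ys ++ z ∷ []) T₂ →
          Triangulation (a ∷ xs ++ m ∷ ys ++ z ∷ []) ((a , m , z) ∷ T₁ ++ T₂)

-- Colour of point i: red / blue / green according as i ≡ 1 / 2 / 0 (mod 3).
colour : ℕ → ℕ
colour i = i % 3

Colourful : Triangle → Set
Colourful (a , b , c) = colour a ≢ colour b × colour b ≢ colour c × colour a ≢ colour c

-- The node set 𝒞'_N (triangulations are considered as sets of triangles,
-- i.e. lists up to permutation, see _↭_ below).
InC' : ℕ → List Triangle → Set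
InC' N T = Triangulation (polygon N) T × All Colourful T

hexA : ℕ → ℕ → ℕ → ℕ → ℕ → ℕ → List Triangle
hexA h₁ h₂ h₃ h₄ h₅ h₆ =
  (h₁ , h₃ , h₅) ∷ (h₁ , h₂ , h₃) ∷ (h₃ , h₄ , h₅) ∷ (h₁ , h₅ , h₆) ∷ []

hexB : ℕ → ℕ → ℕ → ℕ → ℕ → ℕ → List Triangle
hexB h₁ h₂ h₃ h₄ h₅ h₆ =
  (h₂ , h₄ , h₆) ∷ (h₂ , h₃ , h₄) ∷ (h₄ , h₅ , h₆) ∷ (h₁ , h₂ , h₆) ∷ []

Twist : List Triangle → List Triangle → Set
Twist T T' = ∃[ h₁ ] ∃[ h₂ ] ∃[ h₃ ] ∃[ h₄ ] ∃[ h₅ ] ∃[ h₆ ] ∃[ R ]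
  ( h₁ < h₂ × h₂ < h₃ × h₃ < h₄ × h₄ < h₅ × h₅ < h₆ ×
    ( (T ↭ hexA h₁ h₂ h₃ h₄ h₅ h₆ ++ R × T' ↭ hexB h₁ h₂ h₃ h₄ h₅ h₆ ++ R)
    ⊎ (T ↭ hexB h₁ h₂ h₃ h₄ h₅ h₆ ++ R × T' ↭ hexA h₁ h₂ h₃ h₄ h₅ h₆ ++ R)))

data Path (N : ℕ) : List Triangle → List Triangle → Set where
  stop : ∀ {T T'} → T ↭ T' → Path N T T'
  step : ∀ {T U T'} → Twist T U → InC' N U → Path N U T' → Path N T T'

Connected : ℕ → Set
Connected N = ∀ T T' → InC' N T → InC' N T' → Path N T T'

{-# OPTIONS --safe #-}
-- A colourful triangulation of the polygon a, a+1, …, b is a binary tree: the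
-- triangle on the edge ab splits it into the polygons a…m and m…b.  Call
-- b − a mod 3 the gap; a single edge has gap 1, and by colour arithmetic the
-- triangle on ab is colourful iff both halves have the same gap g ≠ 0, the
-- whole then having gap 2g.  So every gap is 1 or 2, and the polygon 1…N with
-- 3 ∣ N has gap 2.  A twist is a tree rotation ((A B) (C D)) E ↔ A ((B C) (D E)).
-- Rotating along the right spine, and then inside the left subtree, brings
-- every tree of gap 2 on a…b other than a single triangle into the form X
-- extended by the triangles (c, c+1, c+2), (a, c, c+2), (a, c+2, c+3), where
-- b = c + 3; recursing on X gives a canonical tree that depends only on a and b.
module Submission where

open import Defs
open import Data.Nat using (ℕ; zero; suc; _<_; _≤_; s≤s; z<s)
open import Data.Nat.Properties using (≤-refl; <-trans; <⇒≤; <-asym; n≮n; n<1+n; m<n+m)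
open import Data.Nat.DivMod using (m%n<n)
open import Data.Nat.Divisibility using (_∣_; n∣m⇒m%n≡0)
open import Data.Nat.Induction using (<-wellFounded)
open import Induction.WellFounded using (Acc; acc)
open import Data.List using (List; []; _∷_; _++_; [_]; map; upTo)
open import Data.List.Properties using (++-assoc; map-upTo)
open import Data.List.Relation.Unary.All using (All; []; _∷_)
import Data.List.Relation.Unary.All.Properties as All
open import Data.List.Relation.Binary.Permutation.Propositional
  using (_↭_; ↭-refl; ↭-sym; ↭-trans; ↭-reflexive)
open import Data.List.Relation.Binary.Permutation.Propositional.Properties
  using (++⁺ʳ; ++-comm; ++-commutativeMonoid) renaming (shift to ↭-shift)
import Algebra.Solver.CommutativeMonoid as CommutativeMonoidSolver
open import Data.Product using (Σ-syntax; ∃-syntax; _×_; _,_; swap)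
import Data.Product as Product
open import Data.Sum using (inj₁)
import Data.Sum as Sum
open import Data.Empty using (⊥-elim)
open import Function using (_∘_)
open import Relation.Nullary using (contradiction)
open import Relation.Binary.PropositionalEquality
  using (_≡_; _≢_; refl; sym; trans; cong; subst; module ≡-Reasoning)
open import Relation.Binary.Construct.Closure.Symmetric using (fwd; bwd)
open import Relation.Binary.Construct.Closure.ReflexiveTransitive using (ε; _◅_; _◅◅_)
open import Relation.Binary.Construct.Closure.Equivalence as EqClosure using (EqClosure)

data Gap : Set where
  one two : Gap

other : Gap → Gap
other one = two
other two = one

variable
  a b c m p q : ℕ
  g g' : Gap
  vs ws xs ys : List ℕ
  T T' U U' : List Triangle

data Tree : Gap → ℕ → ℕ → Set where
  leaf : ∀ a → Tree one a (suc a)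
  node : Tree (other g) a m → Tree (other g) m b → Tree g a b

triangles : Tree g a b → List Triangle
triangles (leaf a) = []
triangles (node {a = a} {m} {b} l r) = (a , m , b) ∷ triangles l ++ triangles r

Tree⇒< : Tree g a b → a < b
Tree⇒< (leaf a) = ≤-refl
Tree⇒< (node l r) = <-trans (Tree⇒< l) (Tree⇒< r)

next : ℕ → ℕ
next 0 = 1
next 1 = 2
next _ = 0

colour-suc : ∀ n → colour (suc n) ≡ next (colour n)
colour-suc 0 = refl
colour-suc 1 = refl
colour-suc 2 = refl
colour-suc (suc (suc (suc n))) = colour-suc n

shift : Gap → ℕ → ℕ
shift one c = next c
shift two c = next (next c)

next³-identity : c < 3 → next (next (next c)) ≡ c
next³-identity {0} _ = refl
next³-identity {1} _ = refl
next³-identity {2} _ = refl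
next³-identity {suc (suc (suc _))} (s≤s (s≤s (s≤s ())))

shift-other-twice : ∀ g → c < 3 → shift (other g) (shift (other g) c) ≡ shift g c
shift-other-twice one c<3 = cong next (next³-identity c<3)
shift-other-twice two _ = refl

shift-other : ∀ g → c < 3 → shift (other g) (shift g c) ≡ c
shift-other one = next³-identity
shift-other two = next³-identity

shift-distinct : ∀ g {c} → c < 3 →
  c ≢ shift g c × shift g c ≢ shift g (shift g c) × c ≢ shift g (shift g c)
shift-distinct one {0} _ = (λ ()) , (λ ()) , (λ ())
shift-distinct one {1} _ = (λ ()) , (λ ()) , (λ ())
shift-distinct one {2} _ = (λ ()) , (λ ()) , (λ ())
shift-distinct two {0} _ = (λ ()) , (λ ()) , (λ ())
shift-distinct two {1} _ = (λ ()) , (λ ()) , (λ ())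
shift-distinct two {2} _ = (λ ()) , (λ ()) , (λ ())
shift-distinct _ {suc (suc (suc _))} (s≤s (s≤s (s≤s ())))

colour-end : Tree g a b → colour b ≡ shift g (colour a)
colour-end (leaf a) = colour-suc a
colour-end {g} (node {a = a} {m} {b} l r) = begin
  colour b                                     ≡⟨ colour-end r ⟩
  shift (other g) (colour m)                   ≡⟨ cong (shift (other g)) (colour-end l) ⟩
  shift (other g) (shift (other g) (colour a)) ≡⟨ shift-other-twice g (m%n<n a 3) ⟩
  shift g (colour a)                           ∎
  where open ≡-Reasoning

colour-mixed : Tree g a m → Tree (other g) m b → colour b ≡ colour a
colour-mixed {g} {a} {m} {b} l r = begin
  colour b                             ≡⟨ colour-end r ⟩
  shift (other g) (colour m)           ≡⟨ cong (shift (other g)) (colour-end l) ⟩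
  shift (other g) (shift g (colour a)) ≡⟨ shift-other g (m%n<n a 3) ⟩
  colour a                             ∎
  where open ≡-Reasoning

node-colourful : Tree g a m → Tree g m b → Colourful (a , m , b)
node-colourful {g} {a} l r rewrite colour-end r | colour-end l = shift-distinct g (m%n<n a 3)

triangles-colourful : (t : Tree g a b) → All Colourful (triangles t)
triangles-colourful (leaf a) = []
triangles-colourful (node l r) =
  node-colourful l r ∷ All.++⁺ (triangles-colourful l) (triangles-colourful r)

colourful-node : Colourful (a , m , b) → (l : Tree g a m) (r : Tree g' m b) →
  ∃[ h ] Σ[ t ∈ Tree h a b ] triangles t ≡ (a , m , b) ∷ triangles l ++ triangles r
colourful-node {g = one} {one} _ l r = two , node l r , refl
colourful-node {g = two} {two} _ l r = one , node l r , refl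
colourful-node {g = one} {two} (_ , _ , a≢b) l r = contradiction (sym (colour-mixed l r)) a≢b
colourful-node {g = two} {one} (_ , _ , a≢b) l r = contradiction (sym (colour-mixed l r)) a≢b

polygon-gap : ∀ {N} → 3 ∣ N → Tree g 1 N → g ≡ two
polygon-gap {one} {N} 3∣N t =
  contradiction (trans (sym (n∣m⇒m%n≡0 N 3 3∣N)) (colour-end t)) λ ()
polygon-gap {two} _ _ = refl

data Interval : ℕ → ℕ → List ℕ → Set where
  point : ∀ a → Interval a a [ a ]
  cons  : Interval (suc a) b vs → Interval a b (a ∷ vs)

Interval⇒≤ : Interval a b vs → a ≤ b
Interval⇒≤ (point a) = ≤-refl
Interval⇒≤ (cons i) = <⇒≤ (Interval⇒≤ i)

Interval-unique : Interval a b vs → Interval a b ws → vs ≡ ws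
Interval-unique (point a) (point a) = refl
Interval-unique (point a) (cons i) = contradiction (Interval⇒≤ i) (n≮n a)
Interval-unique (cons i) (point a) = contradiction (Interval⇒≤ i) (n≮n a)
Interval-unique (cons i) (cons j) = cong (_ ∷_) (Interval-unique i j)

Interval-head : Interval a b (c ∷ vs) → a ≡ c
Interval-head (point _) = refl
Interval-head (cons _) = refl

Interval-last : ∀ xs → Interval a b (xs ++ [ c ]) → b ≡ c
Interval-last [] (point _) = refl
Interval-last (_ ∷ []) (cons i) = Interval-last [] i
Interval-last (_ ∷ y ∷ xs) (cons i) = Interval-last (y ∷ xs) i

Interval-++⁻ : ∀ xs → Interval a b (xs ++ m ∷ ys) →
               Interval a m (xs ++ [ m ]) × Interval m b (m ∷ ys)
Interval-++⁻ [] i@(point _) = point _ , i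
Interval-++⁻ [] i@(cons _) = point _ , i
Interval-++⁻ (_ ∷ []) (cons i) = Product.map₁ cons (Interval-++⁻ [] i)
Interval-++⁻ (_ ∷ y ∷ xs) (cons i) = Product.map₁ cons (Interval-++⁻ (y ∷ xs) i)

Interval-++⁺ : ∀ xs → Interval a m (xs ++ [ m ]) → Interval m b (m ∷ ys) →
               Interval a b (xs ++ m ∷ ys)
Interval-++⁺ [] (point _) j = j
Interval-++⁺ (_ ∷ []) (cons i) j = cons (Interval-++⁺ [] i j)
Interval-++⁺ (_ ∷ y ∷ xs) (cons i) j = cons (Interval-++⁺ (y ∷ xs) i j)

Interval-map-suc : Interval a b vs → Interval (suc a) (suc b) (map suc vs)
Interval-map-suc (point a) = point (suc a)
Interval-map-suc (cons i) = cons (Interval-map-suc i)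

upTo-Interval : ∀ n → Interval 0 n (upTo (suc n))
upTo-Interval zero = point 0
upTo-Interval (suc n) =
  cons (subst (Interval 1 (suc n)) (map-upTo suc (suc n)) (Interval-map-suc (upTo-Interval n)))

polygon-Interval : ∀ n → Interval 1 (suc n) (polygon (suc n))
polygon-Interval n = Interval-map-suc (upTo-Interval n)

Triangulation⇒Tree : Triangulation vs T → Interval a b vs → All Colourful T →
  ∃[ g ] Σ[ t ∈ Tree g a b ] triangles t ≡ T
Triangulation⇒Tree (edge _ _) (cons (point _)) [] = one , leaf _ , refl
Triangulation⇒Tree (split a m z xs ys T₁ T₂ p₁ p₂) i (c ∷ cs)
  with refl ← Interval-head i
  with i₁ , i₂ ← Interval-++⁻ (a ∷ xs) i
  with refl ← Interval-last (m ∷ ys) i₂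
  with _ , l , refl ← Triangulation⇒Tree p₁ i₁ (All.++⁻ˡ T₁ cs)
  with _ , r , refl ← Triangulation⇒Tree p₂ i₂ (All.++⁻ʳ T₁ cs)
  = colourful-node c l r

Tree⇒Triangulation : (t : Tree g a b) →
  ∃[ xs ] Interval a b (a ∷ xs ++ [ b ]) × Triangulation (a ∷ xs ++ [ b ]) (triangles t)
Tree⇒Triangulation (leaf a) = [] , cons (point _) , edge a (suc a)
Tree⇒Triangulation (node {a = a} {m} {b} l r)
  with xs , i₁ , p₁ ← Tree⇒Triangulation l
  with ys , i₂ , p₂ ← Tree⇒Triangulation r
  = xs ++ m ∷ ys ,
    subst (λ vs → Interval a b (a ∷ vs) × Triangulation (a ∷ vs) (triangles (node l r)))
          (sym (++-assoc xs (m ∷ ys) [ b ]))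
          (Interval-++⁺ (a ∷ xs) i₁ i₂ , split a m b xs ys _ _ p₁ p₂)

Tree⇒InC' : ∀ {n} (t : Tree g 1 (suc n)) → InC' (suc n) (triangles t)
Tree⇒InC' t with _ , i , p ← Tree⇒Triangulation t =
  subst (λ vs → Triangulation vs (triangles t)) (Interval-unique i (polygon-Interval _)) p ,
  triangles-colourful t

InC'⇒Tree : ∀ {n} → 3 ∣ suc n → InC' (suc n) T →
            Σ[ t ∈ Tree two 1 (suc n) ] triangles t ≡ T
InC'⇒Tree 3∣N (p , cs)
  with _ , t , t≡T ← Triangulation⇒Tree p (polygon-Interval _) cs
  with refl ← polygon-gap 3∣N t
  = t , t≡T

Twist-sym : Twist T T' → Twist T' T
Twist-sym (h₁ , h₂ , h₃ , h₄ , h₅ , h₆ , R , o₁ , o₂ , o₃ , o₄ , o₅ , hex) =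
  h₁ , h₂ , h₃ , h₄ , h₅ , h₆ , R , o₁ , o₂ , o₃ , o₄ , o₅ , Sum.swap (Sum.map swap swap hex)

Twist-frame : ∀ Q → T ++ Q ↭ U → T' ++ Q ↭ U' → Twist T T' → Twist U U'
Twist-frame {T = T} {U = U} {T' = T'} {U' = U'} Q TQ↭U T'Q↭U'
            (h₁ , h₂ , h₃ , h₄ , h₅ , h₆ , R , o₁ , o₂ , o₃ , o₄ , o₅ , hex) =
  h₁ , h₂ , h₃ , h₄ , h₅ , h₆ , R ++ Q , o₁ , o₂ , o₃ , o₄ , o₅ , Sum.map reframe reframe hex
  where
  reframe₁ : ∀ {X Y H} → X ++ Q ↭ Y → X ↭ H ++ R → Y ↭ H ++ R ++ Q
  reframe₁ {H = H} XQ↭Y X↭HR =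
    ↭-trans (↭-sym XQ↭Y) (↭-trans (++⁺ʳ Q X↭HR) (↭-reflexive (++-assoc H R Q)))

  reframe : ∀ {H H'} → T ↭ H ++ R × T' ↭ H' ++ R → U ↭ H ++ R ++ Q × U' ↭ H' ++ R ++ Q
  reframe = Product.map (reframe₁ TQ↭U) (reframe₁ T'Q↭U')

-- Rotations at nodes of gap two already connect all trees of gap two.
data Rotation : Tree g a b → Tree g a b → Set where
  rotate : ∀ {h₁ h₂ h₃ h₄ h₅ h₆}
    (A : Tree one h₁ h₂) (B : Tree one h₂ h₃) (C : Tree one h₃ h₄)
    (D : Tree one h₄ h₅) (E : Tree one h₅ h₆) →
    Rotation (node (node (node A B) (node C D)) E) (node A (node (node B C) (node D E)))
  left  : {l l' : Tree (other g) a m} {r : Tree (other g) m b} →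
          Rotation l l' → Rotation {g} (node l r) (node l' r)
  right : {l : Tree (other g) a m} {r r' : Tree (other g) m b} →
          Rotation r r' → Rotation {g} (node l r) (node l r')

module ↭-Solver = CommutativeMonoidSolver (++-commutativeMonoid {A = Triangle})
open ↭-Solver using (solve; _⊜_; _⊕_)

left-comb-↭ : ∀ (t₁ t₂ t₃ t₄ : Triangle) (A B C D E : List Triangle) →
  t₄ ∷ (t₁ ∷ (t₂ ∷ A ++ B) ++ (t₃ ∷ C ++ D)) ++ E ↭
  t₁ ∷ t₂ ∷ t₃ ∷ t₄ ∷ (A ++ B ++ C ++ D ++ E)
left-comb-↭ t₁ t₂ t₃ t₄ =
  solve 9 (λ t₁ t₂ t₃ t₄ A B C D E →
             t₄ ⊕ ((t₁ ⊕ ((t₂ ⊕ (A ⊕ B)) ⊕ (t₃ ⊕ (C ⊕ D)))) ⊕ E) ⊜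
             t₁ ⊕ (t₂ ⊕ (t₃ ⊕ (t₄ ⊕ (A ⊕ (B ⊕ (C ⊕ (D ⊕ E))))))))
          ↭-refl [ t₁ ] [ t₂ ] [ t₃ ] [ t₄ ]

right-comb-↭ : ∀ (t₁ t₂ t₃ t₄ : Triangle) (A B C D E : List Triangle) →
  t₄ ∷ A ++ (t₁ ∷ (t₂ ∷ B ++ C) ++ (t₃ ∷ D ++ E)) ↭
  t₁ ∷ t₂ ∷ t₃ ∷ t₄ ∷ (A ++ B ++ C ++ D ++ E)
right-comb-↭ t₁ t₂ t₃ t₄ =
  solve 9 (λ t₁ t₂ t₃ t₄ A B C D E →
             t₄ ⊕ (A ⊕ (t₁ ⊕ ((t₂ ⊕ (B ⊕ C)) ⊕ (t₃ ⊕ (D ⊕ E))))) ⊜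
             t₁ ⊕ (t₂ ⊕ (t₃ ⊕ (t₄ ⊕ (A ⊕ (B ⊕ (C ⊕ (D ⊕ E))))))))
          ↭-refl [ t₁ ] [ t₂ ] [ t₃ ] [ t₄ ]

Rotation⇒Twist : {s s' : Tree g a b} → Rotation s s' → Twist (triangles s) (triangles s')
Rotation⇒Twist (rotate A B C D E) =
  _ , _ , _ , _ , _ , _ , _ , Tree⇒< A , Tree⇒< B , Tree⇒< C , Tree⇒< D , Tree⇒< E ,
  inj₁ ( left-comb-↭ _ _ _ _
           (triangles A) (triangles B) (triangles C) (triangles D) (triangles E)
       , right-comb-↭ _ _ _ _
           (triangles A) (triangles B) (triangles C) (triangles D) (triangles E))
Rotation⇒Twist (left {l = l} {l'} {r} ρ) =
  Twist-frame (_ ∷ triangles r) (↭-shift _ (triangles l) _) (↭-shift _ (triangles l') _)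
              (Rotation⇒Twist ρ)
Rotation⇒Twist (right {l = l} {r} {r'} ρ) =
  Twist-frame (_ ∷ triangles l) (++-comm (triangles r) _) (++-comm (triangles r') _)
              (Rotation⇒Twist ρ)

infix 4 _∼_
_∼_ : Tree g a b → Tree g a b → Set
_∼_ = EqClosure Rotation

node-congˡ : {l l' : Tree (other g) a m} {r : Tree (other g) m b} →
             l ∼ l' → node {g} l r ∼ node l' r
node-congˡ {r = r} = EqClosure.gmap (λ l → node l r) left

node-congʳ : {l : Tree (other g) a m} {r r' : Tree (other g) m b} →
             r ∼ r' → node {g} l r ∼ node l r'
node-congʳ {l = l} = EqClosure.gmap (node l) right

∼⇒Path : ∀ {n} {s s' : Tree g 1 (suc n)} → s ∼ s' → Path (suc n) (triangles s) (triangles s')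
∼⇒Path ε = stop ↭-refl
∼⇒Path (fwd ρ ◅ p) = step (Rotation⇒Twist ρ) (Tree⇒InC' _) (∼⇒Path p)
∼⇒Path (bwd ρ ◅ p) = step (Twist-sym (Rotation⇒Twist ρ)) (Tree⇒InC' _) (∼⇒Path p)

triangle : ∀ a → Tree two a (suc (suc a))
triangle a = node (leaf a) (leaf (suc a))

extend : Tree two a c → Tree two a (suc (suc (suc c)))
extend {c = c} X = node (node X (triangle c)) (leaf (suc (suc c)))

extend-cong : {X X' : Tree two a c} → X ∼ X' → extend X ∼ extend X'
extend-cong = node-congˡ ∘ node-congˡ

data Canonical : Tree two a b → Set where
  canonical-triangle : Canonical (triangle a)
  canonical-extend   : {X : Tree two a c} → Canonical X → Canonical (extend X)

Canonical-unique : {s s' : Tree two a b} → Canonical s → Canonical s' → s ≡ s'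
Canonical-unique canonical-triangle canonical-triangle = refl
Canonical-unique canonical-triangle (canonical-extend {X = X} _) =
  ⊥-elim (<-asym (n<1+n _) (Tree⇒< X))
Canonical-unique (canonical-extend {X = X} _) canonical-triangle =
  ⊥-elim (<-asym (n<1+n _) (Tree⇒< X))
Canonical-unique (canonical-extend p) (canonical-extend q) = cong extend (Canonical-unique p q)

data RightLeaf : Tree two a b → Set where
  rightLeaf : (u : Tree one a m) → RightLeaf (node u (leaf m))

toRightLeaf : (u : Tree one a m) (v : Tree one m b) →
              Σ[ s ∈ Tree two a b ] node u v ∼ s × RightLeaf s
toRightLeaf u (leaf m) = node u (leaf m) , ε , rightLeaf u
toRightLeaf u (node (node B C) (node D E))
  with s , ∼s , rl ← toRightLeaf (node (node u B) (node C D)) E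
  = s , bwd (rotate u B C D E) ◅ ∼s , rl

data Extension : Tree two a b → Set where
  extension : (X : Tree two a c) → Extension (extend X)

absorb : (w : Tree one a p) (x : Tree one p q) (y : Tree one q c) →
  Σ[ s ∈ Tree two a (suc (suc c)) ]
    node (node (node w x) (node y (leaf c))) (leaf (suc c)) ∼ s × Extension s
absorb w x (leaf _) = extend (node w x) , ε , extension (node w x)
absorb w x (node (node A B) (node C D))
  with s , ∼s , ext ← absorb w (node (node x A) (node B C)) D
  = s , fwd (rotate w x (node (node A B) (node C D)) (leaf _) (leaf _))
      ◅ bwd (right (left (rotate x A B C D)))
      ◅ bwd (rotate w (node (node x A) (node B C)) D (leaf _) (leaf _))
      ◅ ∼s , ext

normalise : Acc _<_ b → (s : Tree two a b) → Σ[ s' ∈ Tree two a b ] s ∼ s' × Canonical s'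
normalise rec (node u v) with toRightLeaf u v
... | _ , s∼ , rightLeaf (leaf a) = triangle a , s∼ , canonical-triangle
... | _ , s∼ , rightLeaf (node (node w x) (node y z))
  with _ , yz∼ , rightLeaf y' ← toRightLeaf y z
  with _ , ∼X , extension X ← absorb w x y'
  with acc smaller ← rec
  with X' , X∼X' , canonical ← normalise (smaller (m<n+m _ z<s)) X
  = extend X' ,
    s∼ ◅◅ node-congˡ (node-congʳ yz∼) ◅◅ ∼X ◅◅ extend-cong X∼X' ,
    canonical-extend canonical

gap-two-connected : (s s' : Tree two a b) → s ∼ s'
gap-two-connected s s'
  with c , s∼c , canonical ← normalise (<-wellFounded _) s
  with c' , s'∼c' , canonical' ← normalise (<-wellFounded _) s'
  with refl ← Canonical-unique canonical canonical'
  = s∼c ◅◅ EqClosure.symmetric Rotation s'∼c'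

theorem9 : ∀ (N : ℕ) → 3 ∣ N → Connected N
theorem9 zero _ _ _ (() , _) _
theorem9 (suc n) 3∣N T T' inC inC'
  with t , refl ← InC'⇒Tree 3∣N inC
  with t' , refl ← InC'⇒Tree 3∣N inC'
  = ∼⇒Path (gap-two-connected t t')
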